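{- Let $k,\ell,r,s$ be positive integers with $s^k\mid r$. Then $s^{k+\ell}\mid \binom{r}{j}s^j$ for every integer $j$ with $1\le j\le r$ satisfying $2^{j-\ell+1}>j$. In particular, $s^{k+2}\mid \binom{r}{j}s^j$ for all integers $3\le j\le r$. -}

module Defs where

-- The absorption identity j · C(r, j) = r · C(r − 1, j − 1) gives
-- s^k · s^j ∣ j · C(r, j) s^j. Write j = ℓ + m; the hypothesis 2^(j−ℓ+1) > j says
-- j < 2^(m+1). The factor j can then be cancelled at the price of s^m: if
-- gcd(j, s) = 1 it is coprime to every power of s, and otherwise dividing both
-- j and s by their gcd c ≥ 2 trades one factor s for a j at least halved, which
-- can happen at most m times.
module Submission where

open import Defs
open import Data.Nat using (ℕ; _+_; _*_; _^_; _≤_; _<_)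
open import Data.Nat.Divisibility using (_∣_)
open import Data.Nat.Combinatorics using (_C_)
open import Data.Product using (_×_)

open import Data.Nat using (zero; suc; z≤n; s≤s; NonZero; >-nonZero)
open import Data.Nat.Properties
open import Data.Nat.Divisibility
  using (divides; ∣-refl; ∣-trans; _∣0; 0∣⇒≡0; ∣1⇒≡1; m∣m*n; *-pres-∣; *-cancelˡ-∣)
open import Data.Nat.Combinatorics using (nC1≡n; nCk+nC[k+1]≡[n+1]C[k+1])
open import Data.Nat.GCD using (module GCD; mkGCD)
open import Data.Nat.Coprimality
  using (Coprime; coprime-divisor; GCD≡1⇒coprime) renaming (sym to coprime-sym)
open import Data.Nat.Tactic.RingSolver using (solve-∀)
open import Data.Product using (∃-syntax; _,_)
open import Data.Sum using (inj₁; inj₂)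
open import Relation.Binary.PropositionalEquality
open import Relation.Nullary.Negation using (contradiction)

[1+k]*[1+n]C[1+k]≡[1+n]*nCk : ∀ n k → suc k * (suc n C suc k) ≡ suc n * (n C k)
[1+k]*[1+n]C[1+k]≡[1+n]*nCk zero    zero    = refl
[1+k]*[1+n]C[1+k]≡[1+n]*nCk zero    (suc k) = *-zeroʳ (suc (suc k))
[1+k]*[1+n]C[1+k]≡[1+n]*nCk (suc n) zero    =
  trans (+-identityʳ _) (trans (nC1≡n (suc (suc n))) (sym (*-identityʳ _)))
[1+k]*[1+n]C[1+k]≡[1+n]*nCk (suc n) (suc k) = begin
    suc (suc k) * (suc (suc n) C suc (suc k))
  ≡⟨ cong (suc (suc k) *_) (sym (nCk+nC[k+1]≡[n+1]C[k+1] (suc n) (suc k))) ⟩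
    suc (suc k) * (a + b)
  ≡⟨ distribute (suc k) a b ⟩
    suc k * a + a + suc (suc k) * b
  ≡⟨ cong₂ (λ x y → x + a + y) ([1+k]*[1+n]C[1+k]≡[1+n]*nCk n k)
                               ([1+k]*[1+n]C[1+k]≡[1+n]*nCk n (suc k)) ⟩
    suc n * (n C k) + a + suc n * (n C suc k)
  ≡⟨ collect (suc n) (n C k) (n C suc k) a ⟩
    suc n * (n C k + n C suc k) + a
  ≡⟨ cong (λ x → suc n * x + a) (nCk+nC[k+1]≡[n+1]C[k+1] n k) ⟩
    suc n * a + a
  ≡⟨ +-comm (suc n * a) a ⟩
    suc (suc n) * a ∎
  where
  open ≡-Reasoning
  a = suc n C suc k
  b = suc n C suc (suc k)
  distribute : ∀ x a b → suc x * (a + b) ≡ x * a + a + suc x * b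
  distribute = solve-∀
  collect : ∀ y c d a → y * c + a + y * d ≡ y * (c + d) + a
  collect = solve-∀

n∣k*nCk : ∀ n k → n ∣ k * (n C k)
n∣k*nCk n       zero    = n ∣0
n∣k*nCk zero    (suc k) = subst (0 ∣_) (sym (*-zeroʳ (suc k))) ∣-refl
n∣k*nCk (suc n) (suc k) = divides (n C k)
  (trans ([1+k]*[1+n]C[1+k]≡[1+n]*nCk n k) (*-comm (suc n) (n C k)))

coprime-* : ∀ {j s t} → Coprime j s → Coprime j t → Coprime j (s * t)
coprime-* cs ct (d∣j , d∣st) =
  ct (d∣j , coprime-divisor (λ (e∣d , e∣s) → cs (∣-trans e∣d d∣j , e∣s)) d∣st)

coprime-^ : ∀ {j s} → Coprime j s → ∀ n → Coprime j (s ^ n)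
coprime-^ cs zero    (_ , d∣1) = ∣1⇒≡1 d∣1
coprime-^ cs (suc n) = coprime-* cs (coprime-^ cs n)

m*n<2*o⇒m<o : ∀ {m n o} → 2 ≤ n → m * n < 2 * o → m < o
m*n<2*o⇒m<o {m} {n} {o} 2≤n m*n<2*o = *-cancelˡ-< 2 m o
  (≤-<-trans (subst (_≤ m * n) (*-comm m 2) (*-monoʳ-≤ m 2≤n)) m*n<2*o)

∣-cancel-common-factor : ∀ {x y} c s' j' {A} .{{_ : NonZero c}} →
                         x * (s' * c * y) ∣ j' * c * A → x * y ∣ j' * A
∣-cancel-common-factor {x} {y} c s' j' {A} h =
  ∣-trans (m∣m*n s') (*-cancelˡ-∣ c (subst₂ _∣_ (pull-c x y s' c) (pull-c' j' c A) h))
  where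
  pull-c : ∀ x y s' c → x * (s' * c * y) ≡ c * (x * y * s')
  pull-c = solve-∀
  pull-c' : ∀ j' c A → j' * c * A ≡ c * (j' * A)
  pull-c' = solve-∀

s^a*s^m∣j*A⇒s^a∣A : ∀ m {s a j A} → 1 ≤ j → j < 2 ^ suc m →
                    s ^ a * s ^ m ∣ j * A → s ^ a ∣ A
s^a*s^m∣j*A⇒s^a∣A zero {j = 1} _ _ h = subst₂ _∣_ (*-identityʳ _) (*-identityˡ _) h
s^a*s^m∣j*A⇒s^a∣A zero {j = suc (suc _)} _ (s≤s (s≤s ())) _
s^a*s^m∣j*A⇒s^a∣A (suc m) {s} {a} {j} {A} 1≤j j<2^[2+m] h with mkGCD j s
... | zero , g = contradiction (0∣⇒≡0 (GCD.gcd∣m g)) (n>0⇒n≢0 1≤j)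
... | suc zero , g = ∣-trans (m∣m*n (s ^ suc m)) (coprime-divisor coprime h)
  where
  j⊥s = GCD≡1⇒coprime g
  coprime : Coprime (s ^ a * s ^ suc m) j
  coprime = coprime-sym (coprime-* (coprime-^ j⊥s a) (coprime-^ j⊥s (suc m)))
... | c@(suc (suc _)) , GCD.is (divides j' j≡j'c , divides s' s≡s'c) _ =
  s^a*s^m∣j*A⇒s^a∣A m {s} {a} (positive j' (subst (1 ≤_) j≡j'c 1≤j))
    (m*n<2*o⇒m<o (s≤s (s≤s z≤n)) (subst (_< 2 ^ suc (suc m)) j≡j'c j<2^[2+m]))
    (∣-cancel-common-factor {s ^ a} {s ^ m} c s' j'
      (subst₂ (λ t u → s ^ a * (t * s ^ m) ∣ u * A) s≡s'c j≡j'c h))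
  where
  positive : ∀ x {y} → 1 ≤ x * y → 1 ≤ x
  positive (suc _) _ = s≤s z≤n

j*2^ℓ<2^[j+1]⇒∃-excess : ∀ {j ℓ} → 1 ≤ j → j * 2 ^ ℓ < 2 ^ (j + 1) →
                         ∃[ m ] ℓ + m ≡ j × j < 2 ^ suc m
j*2^ℓ<2^[j+1]⇒∃-excess {j} {ℓ} 1≤j j*2^ℓ<2^[j+1] with m≤n⇒∃[o]m+o≡n ℓ≤j
  where
  instance _ = >-nonZero 1≤j
  ℓ≤j : ℓ ≤ j
  ℓ≤j = ≮⇒≥ λ j<ℓ → <⇒≱ j*2^ℓ<2^[j+1] (begin
    2 ^ (j + 1) ≤⟨ ^-monoʳ-≤ 2 (subst (_≤ ℓ) (+-comm 1 j) j<ℓ) ⟩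
    2 ^ ℓ       ≤⟨ m≤n*m (2 ^ ℓ) j ⟩
    j * 2 ^ ℓ   ∎)
    where open ≤-Reasoning
... | m , refl = m , refl , *-cancelʳ-< (2 ^ ℓ) (ℓ + m) (2 ^ suc m)
  (subst ((ℓ + m) * 2 ^ ℓ <_) 2^[ℓ+m+1]≡2^[1+m]*2^ℓ j*2^ℓ<2^[j+1])
  where
  2^[ℓ+m+1]≡2^[1+m]*2^ℓ : 2 ^ (ℓ + m + 1) ≡ 2 ^ suc m * 2 ^ ℓ
  2^[ℓ+m+1]≡2^[1+m]*2^ℓ = trans (cong (2 ^_) (trans (+-comm (ℓ + m) 1) (cong suc (+-comm ℓ m))))
                                  (^-distribˡ-+-* 2 (suc m) ℓ)

s^[k+ℓ]∣rCj*s^j : ∀ {r s} k ℓ j → s ^ k ∣ r → 1 ≤ j → j * 2 ^ ℓ < 2 ^ (j + 1) →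
                  s ^ (k + ℓ) ∣ (r C j) * s ^ j
s^[k+ℓ]∣rCj*s^j {r} {s} k ℓ j s^k∣r 1≤j j*2^ℓ<2^[j+1]
  with j*2^ℓ<2^[j+1]⇒∃-excess {j} {ℓ} 1≤j j*2^ℓ<2^[j+1]
... | m , refl , j<2^[1+m] = s^a*s^m∣j*A⇒s^a∣A m {s} {k + ℓ} 1≤j j<2^[1+m]
  (subst₂ _∣_ (sym s^[k+ℓ]*s^m≡s^k*s^j) (*-assoc j (r C j) (s ^ j))
          (*-pres-∣ (∣-trans s^k∣r (n∣k*nCk r j)) (∣-refl {s ^ j})))
  where
  open ≡-Reasoning
  s^[k+ℓ]*s^m≡s^k*s^j : s ^ (k + ℓ) * s ^ m ≡ s ^ k * s ^ j
  s^[k+ℓ]*s^m≡s^k*s^j = begin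
    s ^ (k + ℓ) * s ^ m ≡⟨ ^-distribˡ-+-* s (k + ℓ) m ⟨
    s ^ (k + ℓ + m)     ≡⟨ cong (s ^_) (+-assoc k ℓ m) ⟩
    s ^ (k + j)         ≡⟨ ^-distribˡ-+-* s k j ⟩
    s ^ k * s ^ j       ∎

2*n<2^n : ∀ {n} → 3 ≤ n → 2 * n < 2 ^ n
2*n<2^n {suc n} 3≤1+n with m≤n⇒m<n∨m≡n 3≤1+n
... | inj₂ refl = n≤1+n 7
... | inj₁ (s≤s 3≤n) = begin-strict
  2 * suc n     ≡⟨ *-suc 2 n ⟩
  2 + 2 * n     <⟨ +-monoʳ-< 2 (2*n<2^n 3≤n) ⟩
  2 + 2 ^ n     ≤⟨ +-monoˡ-≤ (2 ^ n) (^-monoʳ-≤ 2 (≤-trans (s≤s z≤n) 3≤n)) ⟩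
  2 ^ n + 2 ^ n ≡⟨ cong (2 ^ n +_) (+-identityʳ (2 ^ n)) ⟨
  2 ^ suc n     ∎
  where open ≤-Reasoning

n*2^2<2^[n+1] : ∀ {n} → 3 ≤ n → n * 2 ^ 2 < 2 ^ (n + 1)
n*2^2<2^[n+1] {n} 3≤n = begin-strict
  n * 4         ≡⟨ regroup n ⟩
  2 * (2 * n)   <⟨ *-monoʳ-< 2 (2*n<2^n 3≤n) ⟩
  2 ^ suc n     ≡⟨ cong (2 ^_) (+-comm 1 n) ⟩
  2 ^ (n + 1)   ∎
  where
  open ≤-Reasoning
  regroup : ∀ n → n * 4 ≡ 2 * (2 * n)
  regroup = solve-∀

lemma2p3 : (k ℓ r s : ℕ) → 1 ≤ k → 1 ≤ ℓ → 1 ≤ r → 1 ≤ s → s ^ k ∣ r →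
    ((j : ℕ) → 1 ≤ j → j ≤ r → j * 2 ^ ℓ < 2 ^ (j + 1) →
      s ^ (k + ℓ) ∣ (r C j) * s ^ j)
    × ((j : ℕ) → 3 ≤ j → j ≤ r → s ^ (k + 2) ∣ (r C j) * s ^ j)
lemma2p3 k ℓ r s _ _ _ _ s^k∣r =
  (λ j 1≤j _ → s^[k+ℓ]∣rCj*s^j k ℓ j s^k∣r 1≤j) ,
  (λ j 3≤j _ → s^[k+ℓ]∣rCj*s^j k 2 j s^k∣r (≤-trans (s≤s z≤n) 3≤j) (n*2^2<2^[n+1] 3≤j))
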